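{- Let $v_1=v_1(z)$ be the unique root of $z u^3+(z^2-1)u^2-z^3u+z^2=0$ that is a formal Laurent series in $z$ of the form $v_1=\frac1z-z-z^5-2z^7-\cdots$. For $n\ge1$, let $b_n$ be the number of Dyck paths of semilength $n$ in which every descent except the last one has odd length and the last descent has even length, and let $h_0(z)=\sum_{n\ge1}b_nz^{2n}$. Then $$h_0=\frac{z^2}{v_1^2-z^2}=\frac{1}{z^2}-\frac{v_1}{z}-1,$$ and with $Z=z^2$, $h_0=Z^2+2Z^3+4Z^4+10Z^5+26Z^6+68Z^7+\cdots$ (OEIS A113337).
   Context: A Dyck path is a nonempty finite sequence of up-steps $(1,1)$ and down-steps $(1,-1)$ starting at the origin, never going below the $x$-axis and ending on the $x$-axis. A descent is a maximal run of consecutive down-steps; its length is the number of down-steps in it. Since paths are nonempty, the last descent is well defined. -}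

module Defs where

open import Data.Nat as ℕ using (ℕ; zero; suc; _∸_)
open import Data.Integer as ℤ using (ℤ; +_; -_)
open import Data.List using (List; []; _∷_; length; filter; concatMap; map)
open import Data.List.Relation.Unary.All using (All)
open import Data.Bool using (Bool; true; false; _∧_; not)
open import Data.Product using (_×_; _,_)
open import Relation.Binary.PropositionalEquality using (_≡_)
open import Relation.Nullary.Decidable using (Dec; yes; no)

data Step : Set where
  U D : Step

words : ℕ → List (List Step)
words zero    = [] ∷ []
words (suc k) = concatMap (λ w → (U ∷ w) ∷ (D ∷ w) ∷ []) (words k)

dyckFrom : ℕ → List Step → Bool
dyckFrom zero    []      = true
dyckFrom (suc _) []      = false
dyckFrom h       (U ∷ s) = dyckFrom (suc h) s
dyckFrom zero    (D ∷ s) = false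
dyckFrom (suc h) (D ∷ s) = dyckFrom h s

isDyck : List Step → Bool
isDyck = dyckFrom zero

descentsAux : ℕ → List Step → List ℕ
descentsAux zero          []      = []
descentsAux (suc c)       []      = suc c ∷ []
descentsAux zero          (U ∷ s) = descentsAux zero s
descentsAux (suc c)       (U ∷ s) = suc c ∷ descentsAux zero s
descentsAux c             (D ∷ s) = descentsAux (suc c) s

descents : List Step → List ℕ
descents = descentsAux zero

isOdd isEven : ℕ → Bool
isEven zero    = true
isEven (suc n) = isOdd n
isOdd zero     = false
isOdd (suc n)  = isEven n

-- every descent except the last is odd, and the last descent is even
-- (false on the empty list of descents; the empty path is excluded anyway)
descCond : List ℕ → Bool
descCond []           = false
descCond (d ∷ [])     = isEven d
descCond (d ∷ e ∷ ds) = isOdd d ∧ descCond (e ∷ ds)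

count : {A : Set} → (A → Bool) → List A → ℕ
count p []       = 0
count p (x ∷ xs) with p x
... | true  = suc (count p xs)
... | false = count p xs

good : List Step → Bool
good w = isDyck w ∧ descCond (descents w)

b : ℕ → ℕ
b zero    = 0
b (suc n) = count good (words (2 ℕ.* suc n))

-- Formal power series over ℤ in the variable z: coefficient functions

PS : Set
PS = ℕ → ℤ

_≈_ : PS → PS → Set
f ≈ g = ∀ n → f n ≡ g n
infix 4 _≈_

sumTo : ℕ → (ℕ → ℤ) → ℤ
sumTo zero    f = f zero
sumTo (suc n) f = sumTo n f ℤ.+ f (suc n)

_⊕_ _⊖_ _⊛_ : PS → PS → PS
(f ⊕ g) n = f n ℤ.+ g n
(f ⊖ g) n = f n ℤ.- g n
(f ⊛ g) n = sumTo n (λ i → f i ℤ.* g (n ∸ i))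
infixl 6 _⊕_ _⊖_
infixl 7 _⊛_

zpow : ℕ → PS
zpow k n with k ℕ.≟ n
... | yes _ = + 1
... | no  _ = + 0

zeroPS : PS
zeroPS _ = + 0

h₀ : PS
h₀ n with isEven n
... | true  = + b ℕ.⌊ n /2⌋
... | false = + 0

-- Cutting a nonempty Dyck path at its first return to the axis writes it uniquely as
-- U w₁ D w₂ with w₁, w₂ Dyck paths; its descents are those of w₁ with the last one lengthened
-- by one (a single descent of length one if w₁ is empty), followed by those of w₂. Let E be the
-- series of the paths counted by b (descents odd except the last, which is even), O that of
-- the nonempty paths all of whose descents are odd, and X = z². The decomposition gives
--   E = X (O + (1 + E) E)   and   O = X ((1 + E) + (1 + E) O).
-- For w = 1 - X (1 + E), which is z v₁, these say E w = X O and O w = 1 - w, so E w² = X (1 - w);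
-- together with X E = 1 - w - X this is both the cubic equation for w and E (w² - X²) = X².
-- The cubic has a single root with constant term 1: the difference of its values at two such
-- series factors as (a - b) Q with Q(0) = 1, and such a Q is not a zero divisor.

module Submission where

open import Defs
open import Algebra.Bundles using (CommutativeRing; CommutativeMonoid)
open import Algebra.Structures using (IsCommutativeRing)
import Algebra.Solver.Ring
open import Algebra.Solver.Ring.AlmostCommutativeRing using (fromCommutativeRing; _-Raw-AlmostCommutative⟶_)
open import Data.Bool using (Bool; true; false; _∧_)
import Data.Bool.Properties as Bool
open import Data.Bool.ListAction using (all)
open import Data.Integer as ℤ using (ℤ; +_; -_; _+_; _*_; _-_)
open import Data.Integer.Properties as ℤ
  using (+-comm; +-assoc; *-comm; *-assoc; *-distribˡ-+; *-distribʳ-+; *-zeroˡ)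
open import Data.Integer.Tactic.RingSolver using (solve-∀)
open import Data.List using (List; []; _∷_; _++_; length; concatMap; null)
import Data.List.Properties as List
open import Data.Maybe using (Maybe; just; nothing; maybe′)
import Data.Maybe as Maybe
open import Data.Maybe.Properties using (maybe′-map)
open import Data.Nat as ℕ using (ℕ; zero; suc; _∸_)
import Data.Nat.Properties as ℕ
open import Data.Product using (Σ; _×_; _,_; uncurry; map₁)
open import Data.Sum using (inj₁; inj₂)
open import Function using (_∘_)
open import Level using (0ℓ)
open import Relation.Binary.PropositionalEquality
  using (_≡_; _≢_; refl; sym; trans; cong; cong₂; module ≡-Reasoning)
open import Relation.Binary.Structures using (IsEquivalence)
open import Relation.Nullary.Decidable using (yes; no)
open import Relation.Nullary.Negation using (contradiction)

open import Algebra.Properties.CommutativeSemigroup ℤ.+-commutativeSemigroup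
  using (interchange; x∙yz≈y∙xz)
open import Algebra.Properties.CommutativeSemigroup
  (CommutativeMonoid.commutativeSemigroup Bool.∧-commutativeMonoid)
  using () renaming (x∙yz≈y∙xz to ∧-leftComm)

≈-isEquivalence : IsEquivalence _≈_
≈-isEquivalence = record
  { refl  = λ _ → refl
  ; sym   = λ f≈g n → sym (f≈g n)
  ; trans = λ f≈g g≈h n → trans (f≈g n) (g≈h n)
  }

open IsEquivalence ≈-isEquivalence
  using () renaming (refl to ≈-refl; sym to ≈-sym; trans to ≈-trans)

sumTo-cong : ∀ n {a c : ℕ → ℤ} → (∀ i → a i ≡ c i) → sumTo n a ≡ sumTo n c
sumTo-cong zero    a≗c = a≗c 0
sumTo-cong (suc n) a≗c = cong₂ _+_ (sumTo-cong n a≗c) (a≗c (suc n))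

sumTo-zero : ∀ n {a : ℕ → ℤ} → (∀ i → i ℕ.≤ n → a i ≡ + 0) → sumTo n a ≡ + 0
sumTo-zero zero    a≗0 = a≗0 0 ℕ.z≤n
sumTo-zero (suc n) a≗0 =
  cong₂ _+_ (sumTo-zero n (λ i i≤n → a≗0 i (ℕ.m≤n⇒m≤1+n i≤n))) (a≗0 (suc n) ℕ.≤-refl)

sumTo-suc : ∀ n (a : ℕ → ℤ) → sumTo (suc n) a ≡ a 0 + sumTo n (λ i → a (suc i))
sumTo-suc zero    a = refl
sumTo-suc (suc n) a = trans (cong (_+ a (suc (suc n))) (sumTo-suc n a)) (+-assoc (a 0) _ _)

sumTo-+ : ∀ n (a c : ℕ → ℤ) → sumTo n (λ i → a i + c i) ≡ sumTo n a + sumTo n c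
sumTo-+ zero    a c = refl
sumTo-+ (suc n) a c = trans (cong (_+ (a (suc n) + c (suc n))) (sumTo-+ n a c))
                            (interchange (sumTo n a) (sumTo n c) (a (suc n)) (c (suc n)))

sumTo-*ˡ : ∀ n k (a : ℕ → ℤ) → sumTo n (λ i → k * a i) ≡ k * sumTo n a
sumTo-*ˡ zero    k a = refl
sumTo-*ˡ (suc n) k a = trans (cong (_+ (k * a (suc n))) (sumTo-*ˡ n k a)) (sym (*-distribˡ-+ k _ _))

negPS : PS → PS
negPS f n = - f n

tail : PS → PS
tail f n = f (suc n)

_•_ : ℤ → PS → PS
(k • f) n = k * f n
infixr 8 _•_

constPS : ℤ → PS
constPS c zero    = c
constPS c (suc n) = + 0

onePS : PS
onePS = constPS (+ 1)

⊛-suc : ∀ f g n → (f ⊛ g) (suc n) ≡ f 0 * g (suc n) + (tail f ⊛ g) n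
⊛-suc f g n = sumTo-suc n _

⊛-cong : ∀ {f f′ g g′} → f ≈ f′ → g ≈ g′ → f ⊛ g ≈ f′ ⊛ g′
⊛-cong f≈f′ g≈g′ n = sumTo-cong n (λ i → cong₂ _*_ (f≈f′ i) (g≈g′ (n ∸ i)))

⊛-congˡ : ∀ f {g g′} → g ≈ g′ → f ⊛ g ≈ f ⊛ g′
⊛-congˡ f = ⊛-cong (≈-refl {f})

⊛-congʳ : ∀ g {f f′} → f ≈ f′ → f ⊛ g ≈ f′ ⊛ g
⊛-congʳ g f≈f′ = ⊛-cong f≈f′ (≈-refl {g})

⊕-cong : ∀ {f f′ g g′} → f ≈ f′ → g ≈ g′ → f ⊕ g ≈ f′ ⊕ g′
⊕-cong f≈f′ g≈g′ n = cong₂ _+_ (f≈f′ n) (g≈g′ n)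

⊖-cong : ∀ {f f′ g g′} → f ≈ f′ → g ≈ g′ → f ⊖ g ≈ f′ ⊖ g′
⊖-cong f≈f′ g≈g′ n = cong₂ _-_ (f≈f′ n) (g≈g′ n)

⊛-distribˡ : ∀ f g h → f ⊛ (g ⊕ h) ≈ f ⊛ g ⊕ f ⊛ h
⊛-distribˡ f g h n = trans (sumTo-cong n (λ i → *-distribˡ-+ (f i) _ _)) (sumTo-+ n _ _)

⊛-distribʳ : ∀ f g h → (g ⊕ h) ⊛ f ≈ g ⊛ f ⊕ h ⊛ f
⊛-distribʳ f g h n = trans (sumTo-cong n (λ i → *-distribʳ-+ (f (n ∸ i)) (g i) _)) (sumTo-+ n _ _)

•-⊛ : ∀ k f g → (k • f) ⊛ g ≈ k • (f ⊛ g)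
•-⊛ k f g n = trans (sumTo-cong n (λ i → *-assoc k (f i) _)) (sumTo-*ˡ n k _)

zero-⊛ : ∀ f → zeroPS ⊛ f ≈ zeroPS
zero-⊛ f n = sumTo-zero n (λ i _ → *-zeroˡ (f (n ∸ i)))

⊛-comm : ∀ f g → f ⊛ g ≈ g ⊛ f
⊛-comm f g zero          = *-comm (f 0) (g 0)
⊛-comm f g (suc zero)    =
  trans (+-comm (f 0 * g 1) _) (cong₂ _+_ (*-comm (f 1) (g 0)) (*-comm (f 0) (g 1)))
⊛-comm f g (suc (suc n)) = begin
  (f ⊛ g) (suc (suc n))                 ≡⟨ ⊛-suc f g (suc n) ⟩
  fg + (tail f ⊛ g) (suc n)             ≡⟨ cong (_+_ fg) (⊛-comm (tail f) g (suc n)) ⟩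
  fg + (g ⊛ tail f) (suc n)             ≡⟨ cong (_+_ fg) (⊛-suc g (tail f) n) ⟩
  fg + (gf + (tail g ⊛ tail f) n)       ≡⟨ x∙yz≈y∙xz fg gf ((tail g ⊛ tail f) n) ⟩
  gf + (fg + (tail g ⊛ tail f) n)       ≡⟨ cong (λ t → gf + (fg + t)) (⊛-comm (tail g) (tail f) n) ⟩
  gf + (fg + (tail f ⊛ tail g) n)       ≡⟨ cong (_+_ gf) (⊛-suc f (tail g) n) ⟨
  gf + (f ⊛ tail g) (suc n)             ≡⟨ cong (_+_ gf) (⊛-comm (tail g) f (suc n)) ⟨
  gf + (tail g ⊛ f) (suc n)             ≡⟨ ⊛-suc g f (suc n) ⟨
  (g ⊛ f) (suc (suc n))                 ∎
  where
  open ≡-Reasoning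
  fg gf : ℤ
  fg = f 0 * g (suc (suc n))
  gf = g 0 * f (suc (suc n))

⊛-assoc : ∀ f g h → (f ⊛ g) ⊛ h ≈ f ⊛ (g ⊛ h)
⊛-assoc f g h zero    = *-assoc (f 0) (g 0) (h 0)
⊛-assoc f g h (suc n) = begin
  ((f ⊛ g) ⊛ h) (suc n)                            ≡⟨ ⊛-suc (f ⊛ g) h n ⟩
  f 0 * g 0 * h (suc n) + (tail (f ⊛ g) ⊛ h) n      ≡⟨ cong (_+_ (f 0 * g 0 * h (suc n))) tail-step ⟩
  f 0 * g 0 * h (suc n) + (f 0 * (tail g ⊛ h) n + (tail f ⊛ (g ⊛ h)) n)
    ≡⟨ regroup (f 0) (g 0) (h (suc n)) ((tail g ⊛ h) n) ((tail f ⊛ (g ⊛ h)) n) ⟩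
  f 0 * (g 0 * h (suc n) + (tail g ⊛ h) n) + (tail f ⊛ (g ⊛ h)) n
    ≡⟨ cong (λ t → f 0 * t + (tail f ⊛ (g ⊛ h)) n) (⊛-suc g h n) ⟨
  f 0 * (g ⊛ h) (suc n) + (tail f ⊛ (g ⊛ h)) n     ≡⟨ ⊛-suc f (g ⊛ h) n ⟨
  (f ⊛ (g ⊛ h)) (suc n)                            ∎
  where
  open ≡-Reasoning
  tail-step : (tail (f ⊛ g) ⊛ h) n ≡ f 0 * (tail g ⊛ h) n + (tail f ⊛ (g ⊛ h)) n
  tail-step = begin
    (tail (f ⊛ g) ⊛ h) n                         ≡⟨ ⊛-congʳ h (⊛-suc f g) n ⟩
    ((f 0 • tail g ⊕ tail f ⊛ g) ⊛ h) n           ≡⟨ ⊛-distribʳ h (f 0 • tail g) (tail f ⊛ g) n ⟩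
    ((f 0 • tail g) ⊛ h) n + ((tail f ⊛ g) ⊛ h) n
      ≡⟨ cong₂ _+_ (•-⊛ (f 0) (tail g) h n) (⊛-assoc (tail f) g h n) ⟩
    f 0 * (tail g ⊛ h) n + (tail f ⊛ (g ⊛ h)) n   ∎
  regroup : ∀ a b c d e → a * b * c + (a * d + e) ≡ a * (b * c + d) + e
  regroup a b c d e = begin
    a * b * c + (a * d + e)   ≡⟨ cong (λ t → t + (a * d + e)) (*-assoc a b c) ⟩
    a * (b * c) + (a * d + e) ≡⟨ +-assoc (a * (b * c)) (a * d) e ⟨
    a * (b * c) + a * d + e   ≡⟨ cong (_+ e) (*-distribˡ-+ a (b * c) d) ⟨
    a * (b * c + d) + e       ∎

⊛-identityˡ : ∀ f → onePS ⊛ f ≈ f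
⊛-identityˡ f zero    = ℤ.*-identityˡ (f 0)
⊛-identityˡ f (suc n) = trans (⊛-suc onePS f n)
  (trans (cong₂ _+_ (ℤ.*-identityˡ (f (suc n))) (zero-⊛ f n)) (ℤ.+-identityʳ (f (suc n))))

⊛-identityʳ : ∀ f → f ⊛ onePS ≈ f
⊛-identityʳ f n = trans (⊛-comm f onePS n) (⊛-identityˡ f n)

PS-isCommutativeRing : IsCommutativeRing _≈_ _⊕_ _⊛_ negPS zeroPS onePS
PS-isCommutativeRing = record
  { isRing = record
    { +-isAbelianGroup = record
      { isGroup = record
        { isMonoid = record
          { isSemigroup = record
            { isMagma = record { isEquivalence = ≈-isEquivalence ; ∙-cong = ⊕-cong }
            ; assoc   = λ f g h n → +-assoc (f n) (g n) (h n)
            }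
          ; identity = (λ f n → ℤ.+-identityˡ (f n)) , (λ f n → ℤ.+-identityʳ (f n))
          }
        ; inverse = (λ f n → ℤ.+-inverseˡ (f n)) , (λ f n → ℤ.+-inverseʳ (f n))
        ; ⁻¹-cong = λ f≈g n → cong -_ (f≈g n)
        }
      ; comm = λ f g n → +-comm (f n) (g n)
      }
    ; *-cong     = ⊛-cong
    ; *-assoc    = ⊛-assoc
    ; *-identity = ⊛-identityˡ , ⊛-identityʳ
    ; distrib    = ⊛-distribˡ , ⊛-distribʳ
    }
  ; *-comm = ⊛-comm
  }

PS-commutativeRing : CommutativeRing 0ℓ 0ℓ
PS-commutativeRing = record { isCommutativeRing = PS-isCommutativeRing }

constPS-homomorphism : ℤ.+-*-rawRing -Raw-AlmostCommutative⟶ fromCommutativeRing PS-commutativeRing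
constPS-homomorphism = record
  { ⟦_⟧    = constPS
  ; +-homo = λ { a b zero → refl ; a b (suc n) → refl }
  ; *-homo = *-homo
  ; -‿homo = λ { a zero → refl ; a (suc n) → refl }
  ; 0-homo = λ { zero → refl ; (suc n) → refl }
  ; 1-homo = λ _ → refl
  }
  where
  *-homo : ∀ a b → constPS (a * b) ≈ constPS a ⊛ constPS b
  *-homo a b zero    = refl
  *-homo a b (suc n) = sym (trans (⊛-suc (constPS a) (constPS b) n)
                                  (cong₂ _+_ (ℤ.*-zeroʳ a) (zero-⊛ (constPS b) n)))

constPS-≟ : ∀ a b → Maybe (constPS a ≈ constPS b)
constPS-≟ a b with a ℤ.≟ b
... | yes refl = just (λ _ → refl)
... | no  _    = nothing

open Algebra.Solver.Ring
  ℤ.+-*-rawRing (fromCommutativeRing PS-commutativeRing) constPS-homomorphism constPS-≟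
  using (solve; _:=_; _:+_; _:*_; _:-_; con)

zpow-zero : zpow 0 ≈ onePS
zpow-zero zero    = refl
zpow-zero (suc n) = refl

zpow-suc : ∀ k n → zpow (suc k) (suc n) ≡ zpow k n
zpow-suc k n with suc k ℕ.≟ suc n | k ℕ.≟ n
... | yes _         | yes _   = refl
... | no  _         | no  _   = refl
... | yes 1+k≡1+n   | no  k≢n = contradiction (ℕ.suc-injective 1+k≡1+n) k≢n
... | no  1+k≢1+n   | yes k≡n = contradiction (cong suc k≡n) 1+k≢1+n

zpow-suc-⊛ : ∀ k f n → (zpow (suc k) ⊛ f) (suc n) ≡ (zpow k ⊛ f) n
zpow-suc-⊛ k f n = trans (⊛-suc (zpow (suc k)) f n)
  (trans (ℤ.+-identityˡ ((tail (zpow (suc k)) ⊛ f) n)) (⊛-congʳ f (zpow-suc k) n))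

zpow-⊛-shift : ∀ k f n → (zpow k ⊛ f) (k ℕ.+ n) ≡ f n
zpow-⊛-shift zero    f n = trans (⊛-congʳ f zpow-zero n) (⊛-identityˡ f n)
zpow-⊛-shift (suc k) f n = trans (zpow-suc-⊛ k f (k ℕ.+ n)) (zpow-⊛-shift k f n)

zpow-+ : ∀ m n → zpow (m ℕ.+ n) ≈ zpow m ⊛ zpow n
zpow-+ zero    n i       = sym (trans (⊛-congʳ (zpow n) zpow-zero i) (⊛-identityˡ (zpow n) i))
zpow-+ (suc m) n zero    = refl
zpow-+ (suc m) n (suc i) =
  trans (zpow-suc (m ℕ.+ n) i) (trans (zpow-+ m n i) (sym (zpow-suc-⊛ m (zpow n) i)))

⊛-⊖≈0 : ∀ c {r r′} → r ≈ r′ → c ⊛ (r ⊖ r′) ≈ zeroPS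
⊛-⊖≈0 c r≈r′ n =
  sumTo-zero n (λ i _ → trans (cong (c i *_) (ℤ.i≡j⇒i-j≡0 (r≈r′ (n ∸ i)))) (ℤ.*-zeroʳ (c i)))

cubic : PS → PS → PS → PS
cubic P Y w = w ⊛ w ⊛ w ⊕ P ⊛ w ⊛ w ⊖ Y ⊛ w ⊕ Y

cubic-cong : ∀ {P P′ Y Y′ w w′} → P ≈ P′ → Y ≈ Y′ → w ≈ w′ → cubic P Y w ≈ cubic P′ Y′ w′
cubic-cong P≈P′ Y≈Y′ w≈w′ =
  ⊕-cong (⊖-cong (⊕-cong (⊛-cong (⊛-cong w≈w′ w≈w′) w≈w′) (⊛-cong (⊛-cong P≈P′ w≈w′) w≈w′))
                 (⊛-cong Y≈Y′ w≈w′))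
         Y≈Y′

cubic-difference : ∀ P Y a b →
  cubic P Y a ⊖ cubic P Y b ≈ (a ⊖ b) ⊛ (a ⊛ a ⊕ a ⊛ b ⊕ b ⊛ b ⊕ P ⊛ (a ⊕ b) ⊖ Y)
cubic-difference = solve 4 (λ P Y a b →
  (a :* a :* a :+ P :* a :* a :- Y :* a :+ Y) :- (b :* b :* b :+ P :* b :* b :- Y :* b :+ Y)
  := (a :- b) :* (a :* a :+ a :* b :+ b :* b :+ P :* (a :+ b) :- Y)) (λ _ → refl)

-- Each identity writes a target minus its claimed value as a combination of the residuals
-- of the two equations assumed in GeneratingSystem.
residual-E : ∀ X E O → let w = onePS ⊖ X ⊖ X ⊛ E in
  E ⊛ (w ⊛ w ⊖ X ⊛ X) ⊖ X ⊛ X ≈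
  X ⊛ (O ⊖ X ⊛ ((onePS ⊕ E) ⊕ (onePS ⊕ E) ⊛ O))
    ⊕ w ⊛ (E ⊖ X ⊛ (O ⊕ (onePS ⊕ E) ⊛ E))
residual-E = solve 3 (λ X E O → let w = con (+ 1) :- X :- X :* E in
  E :* (w :* w :- X :* X) :- X :* X :=
  X :* (O :- X :* ((con (+ 1) :+ E) :+ (con (+ 1) :+ E) :* O))
    :+ w :* (E :- X :* (O :+ (con (+ 1) :+ E) :* E)))
  (λ _ → refl)

residual-cubic : ∀ X E O → let w = onePS ⊖ X ⊖ X ⊛ E in
  cubic (X ⊖ onePS) (X ⊛ X) w ≈
  X ⊛ X ⊛ (X ⊛ ((onePS ⊕ E) ⊕ (onePS ⊕ E) ⊛ O) ⊖ O)
    ⊕ X ⊛ w ⊛ (X ⊛ (O ⊕ (onePS ⊕ E) ⊛ E) ⊖ E)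
residual-cubic = solve 3 (λ X E O → let w = con (+ 1) :- X :- X :* E in
  w :* w :* w :+ (X :- con (+ 1)) :* w :* w :- (X :* X) :* w :+ X :* X :=
  X :* X :* (X :* ((con (+ 1) :+ E) :+ (con (+ 1) :+ E) :* O) :- O)
    :+ X :* w :* (X :* (O :+ (con (+ 1) :+ E) :* E) :- E))
  (λ _ → refl)

f⊛g≈0⇒f≈0 : ∀ {f g} → f ⊛ g ≈ zeroPS → g 0 ≡ + 1 → f ≈ zeroPS
f⊛g≈0⇒f≈0 {f} {g} fg≈0 g₀≡1 n = vanishes-up-to n n ℕ.≤-refl
  where
  open ≡-Reasoning
  vanishes-up-to : ∀ n i → i ℕ.≤ n → f i ≡ + 0
  vanishes-up-to zero    .zero ℕ.z≤n = begin
    f 0           ≡⟨ ℤ.*-identityʳ (f 0) ⟨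
    f 0 * + 1     ≡⟨ cong (f 0 *_) g₀≡1 ⟨
    (f ⊛ g) 0     ≡⟨ fg≈0 0 ⟩
    + 0           ∎
  vanishes-up-to (suc n) i i≤1+n with ℕ.m≤n⇒m<n∨m≡n i≤1+n
  ... | inj₁ (ℕ.s≤s i≤n) = vanishes-up-to n i i≤n
  ... | inj₂ refl        = begin
    f (suc n)                        ≡⟨ ℤ.*-identityʳ (f (suc n)) ⟨
    f (suc n) * + 1                  ≡⟨ cong (f (suc n) *_) (trans (cong g (ℕ.n∸n≡0 n)) g₀≡1) ⟨
    f (suc n) * g (n ∸ n)            ≡⟨ ℤ.+-identityˡ _ ⟨
    + 0 + f (suc n) * g (n ∸ n)      ≡⟨ cong (_+ f (suc n) * g (n ∸ n)) lower-terms ⟨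
    (f ⊛ g) (suc n)                  ≡⟨ fg≈0 (suc n) ⟩
    + 0                              ∎
    where
    lower-terms : sumTo n (λ j → f j * g (suc n ∸ j)) ≡ + 0
    lower-terms = sumTo-zero n (λ j j≤n →
      trans (cong (_* g (suc n ∸ j)) (vanishes-up-to n j j≤n)) (*-zeroˡ (g (suc n ∸ j))))

cubic-unique : ∀ {P Y a b} → P 0 ≡ - + 1 → Y 0 ≡ + 0 → a 0 ≡ + 1 → b 0 ≡ + 1 →
               cubic P Y a ≈ cubic P Y b → a ≈ b
cubic-unique {P} {Y} {a} {b} P₀ Y₀ a₀ b₀ Ca≈Cb n =
  ℤ.i-j≡0⇒i≡j (a n) (b n)
    (f⊛g≈0⇒f≈0 {a ⊖ b} {quotient} difference-vanishes (quotient-unit P₀ Y₀ a₀ b₀) n)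
  where
  quotient : PS
  quotient = a ⊛ a ⊕ a ⊛ b ⊕ b ⊛ b ⊕ P ⊛ (a ⊕ b) ⊖ Y
  difference-vanishes : (a ⊖ b) ⊛ quotient ≈ zeroPS
  difference-vanishes m = trans (sym (cubic-difference P Y a b m)) (ℤ.i≡j⇒i-j≡0 (Ca≈Cb m))
  quotient-unit : ∀ {p y a b : ℤ} → p ≡ - + 1 → y ≡ + 0 → a ≡ + 1 → b ≡ + 1 →
                  a * a + a * b + b * b + p * (a + b) - y ≡ + 1
  quotient-unit refl refl refl refl = refl

module GeneratingSystem (X E O : PS)
  (E-eq : E ≈ X ⊛ (O ⊕ (onePS ⊕ E) ⊛ E))
  (O-eq : O ≈ X ⊛ ((onePS ⊕ E) ⊕ (onePS ⊕ E) ⊛ O)) where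

  w : PS
  w = onePS ⊖ X ⊖ X ⊛ E

  E-closed-form : E ⊛ (w ⊛ w ⊖ X ⊛ X) ≈ X ⊛ X
  E-closed-form n = ℤ.i-j≡0⇒i≡j _ _ (trans (residual-E X E O n)
    (cong₂ _+_ (⊛-⊖≈0 X O-eq n) (⊛-⊖≈0 w E-eq n)))

  w-cubic : cubic (X ⊖ onePS) (X ⊛ X) w ≈ zeroPS
  w-cubic n = trans (residual-cubic X E O n)
    (cong₂ _+_ (⊛-⊖≈0 (X ⊛ X) (≈-sym O-eq) n) (⊛-⊖≈0 (X ⊛ w) (≈-sym E-eq) n))

weight : Bool → ℤ
weight true  = + 1
weight false = + 0

gf : (List Step → Bool) → PS
gf p zero    = weight (p [])
gf p (suc n) = gf (p ∘ (U ∷_)) n + gf (p ∘ (D ∷_)) n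

gf-cong : ∀ {p q} → (∀ w → p w ≡ q w) → gf p ≈ gf q
gf-cong p≗q zero    = cong weight (p≗q [])
gf-cong p≗q (suc n) = cong₂ _+_ (gf-cong (p≗q ∘ (U ∷_)) n) (gf-cong (p≗q ∘ (D ∷_)) n)

gf-split : ∀ {p q r} → (∀ w → weight (p w) ≡ weight (q w) + weight (r w)) → gf p ≈ gf q ⊕ gf r
gf-split p≗q+r zero    = p≗q+r []
gf-split {q = q} {r} p≗q+r (suc n) =
  trans (cong₂ _+_ (gf-split (p≗q+r ∘ (U ∷_)) n) (gf-split (p≗q+r ∘ (D ∷_)) n))
        (interchange (gf (q ∘ (U ∷_)) n) (gf (r ∘ (U ∷_)) n) _ _)

gf-vanishes : ∀ {p} n → (∀ w → length w ≡ n → p w ≡ false) → gf p n ≡ + 0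
gf-vanishes zero    p≡false = cong weight (p≡false [] refl)
gf-vanishes (suc n) p≡false = cong₂ _+_ (gf-vanishes n (λ w → p≡false (U ∷ w) ∘ cong suc))
                                        (gf-vanishes n (λ w → p≡false (D ∷ w) ∘ cong suc))

gf-false : ∀ {p} → (∀ w → p w ≡ false) → gf p ≈ zeroPS
gf-false p≡false n = gf-vanishes n (λ w _ → p≡false w)

count-∷ : ∀ {A : Set} (p : A → Bool) x xs → + count p (x ∷ xs) ≡ weight (p x) + + count p xs
count-∷ p x xs with p x
... | true  = refl
... | false = refl

count-words : ∀ n p → + count p (words n) ≡ gf p n
count-words zero    p with p []
... | true  = refl
... | false = refl
count-words (suc n) p = trans (count-branches (words n))
  (cong₂ _+_ (count-words n (p ∘ (U ∷_))) (count-words n (p ∘ (D ∷_))))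
  where
  count-branches : ∀ ws → + count p (concatMap (λ w → (U ∷ w) ∷ (D ∷ w) ∷ []) ws)
                        ≡ + count (p ∘ (U ∷_)) ws + + count (p ∘ (D ∷_)) ws
  count-branches []       = refl
  count-branches (w ∷ ws) = begin
    + count p ((U ∷ w) ∷ (D ∷ w) ∷ rest)
      ≡⟨ trans (count-∷ p (U ∷ w) _) (cong (_+_ pU) (count-∷ p (D ∷ w) _)) ⟩
    pU + (pD + + count p rest)                              ≡⟨ ℤ.+-assoc pU pD _ ⟨
    pU + pD + + count p rest                                ≡⟨ cong (_+_ (pU + pD)) (count-branches ws) ⟩
    pU + pD + (+ count (p ∘ (U ∷_)) ws + + count (p ∘ (D ∷_)) ws)
      ≡⟨ interchange pU pD _ _ ⟩
    pU + + count (p ∘ (U ∷_)) ws + (pD + + count (p ∘ (D ∷_)) ws)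
      ≡⟨ cong₂ _+_ (count-∷ (p ∘ (U ∷_)) w ws) (count-∷ (p ∘ (D ∷_)) w ws) ⟨
    + count (p ∘ (U ∷_)) (w ∷ ws) + + count (p ∘ (D ∷_)) (w ∷ ws) ∎
    where
    open ≡-Reasoning
    pU pD : ℤ
    pU = weight (p (U ∷ w))
    pD = weight (p (D ∷ w))
    rest : List (List Step)
    rest = concatMap (λ w → (U ∷ w) ∷ (D ∷ w) ∷ []) ws

dyckFrom-U : ∀ h s → dyckFrom h (U ∷ s) ≡ dyckFrom (suc h) s
dyckFrom-U zero    s = refl
dyckFrom-U (suc h) s = refl

dyckFrom-++ : ∀ h k xs ys → dyckFrom h xs ≡ true → dyckFrom (h ℕ.+ k) (xs ++ ys) ≡ dyckFrom k ys
dyckFrom-++ zero    k []       ys _ = refl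
dyckFrom-++ (suc h) k []       ys ()
dyckFrom-++ h       k (U ∷ xs) ys d = trans (dyckFrom-U (h ℕ.+ k) (xs ++ ys))
  (dyckFrom-++ (suc h) k xs ys (trans (sym (dyckFrom-U h xs)) d))
dyckFrom-++ zero    k (D ∷ xs) ys ()
dyckFrom-++ (suc h) k (D ∷ xs) ys d = dyckFrom-++ h k xs ys d

dyckFrom-even : ∀ h w → dyckFrom h w ≡ true → isEven (length w ℕ.+ h) ≡ true
dyckFrom-even zero    []       _ = refl
dyckFrom-even (suc h) []       ()
dyckFrom-even h       (U ∷ w) d = trans (cong isEven (sym (ℕ.+-suc (length w) h)))
  (dyckFrom-even (suc h) w (trans (sym (dyckFrom-U h w)) d))
dyckFrom-even zero    (D ∷ w) ()
dyckFrom-even (suc h) (D ∷ w) d = trans (cong isOdd (ℕ.+-suc (length w) h)) (dyckFrom-even h w d)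

dyckFromWith : ℕ → (List Step → Bool) → List Step → Bool
dyckFromWith h P w = dyckFrom h w ∧ P w

-- firstReturn h v cuts v = w₁ ++ D ∷ w₂ at the first step taking a path started at height h
-- below the axis.
firstReturn : ℕ → List Step → Maybe (List Step × List Step)
firstReturn h       []      = nothing
firstReturn h       (U ∷ v) = Maybe.map (map₁ (U ∷_)) (firstReturn (suc h) v)
firstReturn zero    (D ∷ v) = just ([] , v)
firstReturn (suc h) (D ∷ v) = Maybe.map (map₁ (D ∷_)) (firstReturn h v)

viaFirstReturn : ℕ → (List Step → Bool) → (List Step → Bool) → List Step → Bool
viaFirstReturn h P Q v = maybe′ (uncurry λ w₁ w₂ → P w₁ ∧ Q w₂) false (firstReturn h v)

firstReturn-just : ∀ h v {w₁ w₂} → firstReturn h v ≡ just (w₁ , w₂) →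
                   v ≡ w₁ ++ D ∷ w₂ × dyckFrom h w₁ ≡ true
firstReturn-just h (U ∷ v) eq with firstReturn (suc h) v in eq′
firstReturn-just h (U ∷ v) refl | just (w₁ , w₂) with firstReturn-just (suc h) v eq′
... | refl , d = refl , trans (dyckFrom-U h w₁) d
firstReturn-just zero    (D ∷ v) refl = refl , refl
firstReturn-just (suc h) (D ∷ v) eq with firstReturn h v in eq′
firstReturn-just (suc h) (D ∷ v) refl | just (w₁ , w₂) with firstReturn-just h v eq′
... | refl , d = refl , d

firstReturn-nothing : ∀ h v → firstReturn h v ≡ nothing → dyckFrom (suc h) v ≡ false
firstReturn-nothing h       []      _  = refl
firstReturn-nothing h       (U ∷ v) eq with firstReturn (suc h) v in eq′
... | nothing = firstReturn-nothing (suc h) v eq′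
firstReturn-nothing (suc h) (D ∷ v) eq with firstReturn h v in eq′
... | nothing = firstReturn-nothing h v eq′

viaFirstReturn-U : ∀ h P Q v →
                   viaFirstReturn h P Q (U ∷ v) ≡ viaFirstReturn (suc h) (P ∘ (U ∷_)) Q v
viaFirstReturn-U h P Q v = maybe′-map _ false (map₁ (U ∷_)) (firstReturn (suc h) v)

viaFirstReturn-D : ∀ h P Q v →
                   viaFirstReturn (suc h) P Q (D ∷ v) ≡ viaFirstReturn h (P ∘ (D ∷_)) Q v
viaFirstReturn-D h P Q v = maybe′-map _ false (map₁ (D ∷_)) (firstReturn h v)

weight-∧ : ∀ a b → weight (a ∧ b) ≡ weight a * weight b
weight-∧ true  b = sym (ℤ.*-identityˡ (weight b))
weight-∧ false b = refl

gf-∧ˡ : ∀ a Q → gf (λ w → a ∧ Q w) ≈ weight a • gf Q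
gf-∧ˡ true  Q n = sym (ℤ.*-identityˡ (gf Q n))
gf-∧ˡ false Q n = gf-false (λ _ → refl) n

gf-viaFirstReturn : ∀ n h P Q → gf (viaFirstReturn h P Q) (suc n) ≡ (gf (dyckFromWith h P) ⊛ gf Q) n
gf-viaFirstReturn zero zero    P Q = trans (ℤ.+-identityˡ _) (weight-∧ (P []) (Q []))
gf-viaFirstReturn zero (suc h) P Q = refl
gf-viaFirstReturn (suc n) h P Q = begin
  gf (viaFirstReturn h P Q ∘ (U ∷_)) (suc n) + gf (viaFirstReturn h P Q ∘ (D ∷_)) (suc n)
    ≡⟨ cong₂ _+_ U-branch (D-branch h P) ⟩
  (gf (R ∘ (U ∷_)) ⊛ gf Q) n + (gf R 0 * gf Q (suc n) + (gf (R ∘ (D ∷_)) ⊛ gf Q) n)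
    ≡⟨ x∙yz≈y∙xz ((gf (R ∘ (U ∷_)) ⊛ gf Q) n) (gf R 0 * gf Q (suc n)) _ ⟩
  gf R 0 * gf Q (suc n) + ((gf (R ∘ (U ∷_)) ⊛ gf Q) n + (gf (R ∘ (D ∷_)) ⊛ gf Q) n)
    ≡⟨ cong (_+_ (gf R 0 * gf Q (suc n))) (⊛-distribʳ (gf Q) (gf (R ∘ (U ∷_))) (gf (R ∘ (D ∷_))) n) ⟨
  gf R 0 * gf Q (suc n) + (tail (gf R) ⊛ gf Q) n
    ≡⟨ ⊛-suc (gf R) (gf Q) n ⟨
  (gf R ⊛ gf Q) (suc n) ∎
  where
  open ≡-Reasoning
  R : List Step → Bool
  R = dyckFromWith h P
  U-branch : gf (viaFirstReturn h P Q ∘ (U ∷_)) (suc n) ≡ (gf (R ∘ (U ∷_)) ⊛ gf Q) n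
  U-branch = trans (gf-cong (viaFirstReturn-U h P Q) (suc n))
    (trans (gf-viaFirstReturn n (suc h) (P ∘ (U ∷_)) Q)
           (⊛-congʳ (gf Q) (gf-cong (λ w → cong (_∧ P (U ∷ w)) (sym (dyckFrom-U h w)))) n))
  D-branch : ∀ h P → gf (viaFirstReturn h P Q ∘ (D ∷_)) (suc n)
             ≡ gf (dyckFromWith h P) 0 * gf Q (suc n) + (gf (dyckFromWith h P ∘ (D ∷_)) ⊛ gf Q) n
  D-branch zero    P = begin
    gf (λ v → P [] ∧ Q v) (suc n)                   ≡⟨ gf-∧ˡ (P []) Q (suc n) ⟩
    weight (P []) * gf Q (suc n)                    ≡⟨ ℤ.+-identityʳ _ ⟨
    weight (P []) * gf Q (suc n) + + 0              ≡⟨ cong (_+_ (weight (P []) * gf Q (suc n))) (zero-⊛ (gf Q) n) ⟨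
    weight (P []) * gf Q (suc n) + (zeroPS ⊛ gf Q) n
      ≡⟨ cong (_+_ (weight (P []) * gf Q (suc n))) (⊛-congʳ (gf Q) (gf-false (λ _ → refl)) n) ⟨
    weight (P []) * gf Q (suc n) + (gf (λ _ → false) ⊛ gf Q) n ∎
  D-branch (suc h) P = trans (gf-cong (viaFirstReturn-D h P Q) (suc n))
    (trans (gf-viaFirstReturn n h (P ∘ (D ∷_)) Q) (sym (ℤ.+-identityˡ _)))

bump : List ℕ → List ℕ
bump []           = 1 ∷ []
bump (d ∷ [])     = suc d ∷ []
bump (d ∷ e ∷ ds) = d ∷ bump (e ∷ ds)

bump-∷ : ∀ d ds → ds ≢ [] → bump (d ∷ ds) ≡ d ∷ bump ds
bump-∷ d []       ds≢[] = contradiction refl ds≢[]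
bump-∷ d (e ∷ ds) _     = refl

descentsAux-suc-nonempty : ∀ c s → descentsAux (suc c) s ≢ []
descentsAux-suc-nonempty c []      ()
descentsAux-suc-nonempty c (U ∷ s) ()
descentsAux-suc-nonempty c (D ∷ s) = descentsAux-suc-nonempty (suc c) s

no-descents-not-dyck : ∀ h s → descentsAux 0 s ≡ [] → dyckFrom (suc h) s ≡ false
no-descents-not-dyck h []      _  = refl
no-descents-not-dyck h (U ∷ s) eq = no-descents-not-dyck (suc h) s eq
no-descents-not-dyck h (D ∷ s) eq = contradiction eq (descentsAux-suc-nonempty 0 s)

dyck-descents-nonempty : ∀ h s → dyckFrom (suc h) s ≡ true → descentsAux 0 s ≢ []
dyck-descents-nonempty h s d eq with () ← trans (sym d) (no-descents-not-dyck h s eq)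

descentsAux-++-U : ∀ c xs ys → descentsAux c (xs ++ U ∷ ys) ≡ descentsAux c xs ++ descentsAux 0 ys
descentsAux-++-U zero    []       ys = refl
descentsAux-++-U (suc c) []       ys = refl
descentsAux-++-U zero    (U ∷ xs) ys = descentsAux-++-U zero xs ys
descentsAux-++-U (suc c) (U ∷ xs) ys = cong (suc c ∷_) (descentsAux-++-U zero xs ys)
descentsAux-++-U zero    (D ∷ xs) ys = descentsAux-++-U 1 xs ys
descentsAux-++-U (suc c) (D ∷ xs) ys = descentsAux-++-U (suc (suc c)) xs ys

descentsAux-∷ʳ-D : ∀ h c xs → dyckFrom h xs ≡ true →
                   descentsAux c (xs ++ D ∷ []) ≡ bump (descentsAux c xs)
descentsAux-∷ʳ-D zero    zero    []       _ = refl
descentsAux-∷ʳ-D zero    (suc c) []       _ = refl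
descentsAux-∷ʳ-D h       zero    (U ∷ xs) d =
  descentsAux-∷ʳ-D (suc h) zero xs (trans (sym (dyckFrom-U h xs)) d)
descentsAux-∷ʳ-D h       (suc c) (U ∷ xs) d = trans
  (cong (suc c ∷_) (descentsAux-∷ʳ-D (suc h) zero xs d′))
  (sym (bump-∷ (suc c) _ (dyck-descents-nonempty h xs d′)))
  where
  d′ : dyckFrom (suc h) xs ≡ true
  d′ = trans (sym (dyckFrom-U h xs)) d
descentsAux-∷ʳ-D (suc h) zero    (D ∷ xs) d = descentsAux-∷ʳ-D h 1 xs d
descentsAux-∷ʳ-D (suc h) (suc c) (D ∷ xs) d = descentsAux-∷ʳ-D h (suc (suc c)) xs d

oddExceptLast : (ℕ → Bool) → List ℕ → Bool
oddExceptLast p []           = false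
oddExceptLast p (d ∷ [])     = p d
oddExceptLast p (d ∷ e ∷ ds) = isOdd d ∧ oddExceptLast p (e ∷ ds)

orEmpty : (List ℕ → Bool) → List ℕ → Bool
orEmpty C []       = true
orEmpty C (d ∷ ds) = C (d ∷ ds)

descCond-oddExceptLast : ∀ ds → descCond ds ≡ oddExceptLast isEven ds
descCond-oddExceptLast []           = refl
descCond-oddExceptLast (d ∷ [])     = refl
descCond-oddExceptLast (d ∷ e ∷ ds) = cong (isOdd d ∧_) (descCond-oddExceptLast (e ∷ ds))

oddExceptLast-bump-∷ : ∀ p d ds → oddExceptLast p (bump (d ∷ ds)) ≡ oddExceptLast (p ∘ suc) (d ∷ ds)
oddExceptLast-bump-∷ p d []           = refl
oddExceptLast-bump-∷ p d (e ∷ [])     = refl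
oddExceptLast-bump-∷ p d (e ∷ f ∷ ds) = cong (isOdd d ∧_) (oddExceptLast-bump-∷ p e (f ∷ ds))

oddExceptLast-even-bump : ∀ ds → oddExceptLast isEven (bump ds) ≡ oddExceptLast isOdd ds
oddExceptLast-even-bump []       = refl
oddExceptLast-even-bump (d ∷ ds) = oddExceptLast-bump-∷ isEven d ds

oddExceptLast-odd-bump : ∀ ds → oddExceptLast isOdd (bump ds) ≡ orEmpty (oddExceptLast isEven) ds
oddExceptLast-odd-bump []       = refl
oddExceptLast-odd-bump (d ∷ ds) = oddExceptLast-bump-∷ isOdd d ds

oddExceptLast-++ : ∀ p ds e es →
                   oddExceptLast p (ds ++ e ∷ es) ≡ all isOdd ds ∧ oddExceptLast p (e ∷ es)
oddExceptLast-++ p []            e es = refl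
oddExceptLast-++ p (d ∷ [])      e es =
  cong (_∧ oddExceptLast p (e ∷ es)) (sym (Bool.∧-identityʳ (isOdd d)))
oddExceptLast-++ p (d ∷ d′ ∷ ds) e es =
  trans (cong (isOdd d ∧_) (oddExceptLast-++ p (d′ ∷ ds) e es))
        (sym (Bool.∧-assoc (isOdd d) (all isOdd (d′ ∷ ds)) _))

all-odd-bump : ∀ ds → all isOdd (bump ds) ≡ orEmpty (oddExceptLast isEven) ds
all-odd-bump []           = refl
all-odd-bump (d ∷ [])     = Bool.∧-identityʳ (isEven d)
all-odd-bump (d ∷ e ∷ ds) = cong (isOdd d ∧_) (all-odd-bump (e ∷ ds))

descents-++-DU : ∀ xs ys → isDyck xs ≡ true →
                 descents (xs ++ D ∷ U ∷ ys) ≡ bump (descents xs) ++ descentsAux 0 ys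
descents-++-DU xs ys d = begin
  descentsAux 0 (xs ++ D ∷ U ∷ ys)
    ≡⟨ cong (descentsAux 0) (List.++-assoc xs (D ∷ []) (U ∷ ys)) ⟨
  descentsAux 0 ((xs ++ D ∷ []) ++ U ∷ ys)
    ≡⟨ descentsAux-++-U 0 (xs ++ D ∷ []) ys ⟩
  descentsAux 0 (xs ++ D ∷ []) ++ descentsAux 0 ys
    ≡⟨ cong (_++ descentsAux 0 ys) (descentsAux-∷ʳ-D 0 0 xs d) ⟩
  bump (descents xs) ++ descentsAux 0 ys ∎
  where open ≡-Reasoning

dyckOddExceptLast : (ℕ → Bool) → List Step → Bool
dyckOddExceptLast p = dyckFromWith 0 (oddExceptLast p ∘ descents)

dyckGoodOrEmpty : List Step → Bool
dyckGoodOrEmpty = dyckFromWith 0 (orEmpty (oddExceptLast isEven) ∘ descents)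

firstReturn-oddExceptLast : ∀ p w₁ w₂ → isDyck w₁ ≡ true →
  weight (dyckOddExceptLast p (U ∷ w₁ ++ D ∷ w₂))
  ≡ weight (oddExceptLast p (bump (descents w₁)) ∧ null w₂)
  + weight (orEmpty (oddExceptLast isEven) (descents w₁) ∧ dyckOddExceptLast p w₂)
firstReturn-oddExceptLast p w₁ [] d
  rewrite dyckFrom-++ 0 1 w₁ (D ∷ []) d | descentsAux-∷ʳ-D 0 0 w₁ d
        | Bool.∧-identityʳ (oddExceptLast p (bump (descents w₁)))
        | Bool.∧-zeroʳ (orEmpty (oddExceptLast isEven) (descents w₁))
  = sym (ℤ.+-identityʳ _)
firstReturn-oddExceptLast p w₁ (D ∷ w) d
  rewrite dyckFrom-++ 0 1 w₁ (D ∷ D ∷ w) d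
        | Bool.∧-zeroʳ (oddExceptLast p (bump (descents w₁)))
        | Bool.∧-zeroʳ (orEmpty (oddExceptLast isEven) (descents w₁))
  = refl
firstReturn-oddExceptLast p w₁ (U ∷ w) d
  rewrite dyckFrom-++ 0 1 w₁ (D ∷ U ∷ w) d | descents-++-DU w₁ w d
        | Bool.∧-zeroʳ (oddExceptLast p (bump (descents w₁)))
  with descentsAux 0 w in eq
... | []
  rewrite no-descents-not-dyck 0 w eq | Bool.∧-zeroʳ (orEmpty (oddExceptLast isEven) (descents w₁))
  = refl
... | e ∷ es
  rewrite oddExceptLast-++ p (bump (descents w₁)) e es | all-odd-bump (descents w₁)
  = trans (cong weight (∧-leftComm (dyckFrom 1 w) (orEmpty (oddExceptLast isEven) (descents w₁)) _))
          (sym (ℤ.+-identityˡ _))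

dyckOddExceptLast-U : ∀ p v → weight (dyckOddExceptLast p (U ∷ v))
  ≡ weight (viaFirstReturn 0 (oddExceptLast p ∘ bump ∘ descents) null v)
  + weight (viaFirstReturn 0 (orEmpty (oddExceptLast isEven) ∘ descents) (dyckOddExceptLast p) v)
dyckOddExceptLast-U p v with firstReturn 0 v in eq
... | nothing rewrite firstReturn-nothing 0 v eq = refl
... | just (w₁ , w₂) with firstReturn-just 0 v eq
...   | refl , w₁-dyck = firstReturn-oddExceptLast p w₁ w₂ w₁-dyck

gf-null : gf null ≈ onePS
gf-null zero    = refl
gf-null (suc n) = cong₂ _+_ (gf-false (λ _ → refl) n) (gf-false (λ _ → refl) n)

gf-dyckOddExceptLast : ∀ p → gf (dyckOddExceptLast p)
  ≈ zpow 2 ⊛ (gf (dyckFromWith 0 (oddExceptLast p ∘ bump ∘ descents))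
              ⊕ gf dyckGoodOrEmpty ⊛ gf (dyckOddExceptLast p))
gf-dyckOddExceptLast p zero          = refl
gf-dyckOddExceptLast p (suc zero)    = refl
gf-dyckOddExceptLast p (suc (suc n)) = begin
  gf (A ∘ (U ∷_)) (suc n) + gf (A ∘ (D ∷_)) (suc n)
    ≡⟨ cong₂ _+_ (gf-split {q = viaFirstReturn 0 P₁ null} {viaFirstReturn 0 P₂ A} (dyckOddExceptLast-U p) (suc n))
                 (gf-false (λ _ → refl) (suc n)) ⟩
  gf (viaFirstReturn 0 P₁ null) (suc n) + gf (viaFirstReturn 0 P₂ A) (suc n) + + 0
    ≡⟨ ℤ.+-identityʳ _ ⟩
  gf (viaFirstReturn 0 P₁ null) (suc n) + gf (viaFirstReturn 0 P₂ A) (suc n)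
    ≡⟨ cong₂ _+_ (gf-viaFirstReturn n 0 P₁ null) (gf-viaFirstReturn n 0 P₂ A) ⟩
  (gf (dyckFromWith 0 P₁) ⊛ gf null) n + (gf dyckGoodOrEmpty ⊛ gf A) n
    ≡⟨ cong (_+ (gf dyckGoodOrEmpty ⊛ gf A) n)
            (trans (⊛-congˡ (gf (dyckFromWith 0 P₁)) gf-null n) (⊛-identityʳ (gf (dyckFromWith 0 P₁)) n)) ⟩
  gf (dyckFromWith 0 P₁) n + (gf dyckGoodOrEmpty ⊛ gf A) n
    ≡⟨ zpow-⊛-shift 2 (gf (dyckFromWith 0 P₁) ⊕ gf dyckGoodOrEmpty ⊛ gf A) n ⟨
  (zpow 2 ⊛ (gf (dyckFromWith 0 P₁) ⊕ gf dyckGoodOrEmpty ⊛ gf A)) (suc (suc n)) ∎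
  where
  open ≡-Reasoning
  A P₁ P₂ : List Step → Bool
  A  = dyckOddExceptLast p
  P₁ = oddExceptLast p ∘ bump ∘ descents
  P₂ = orEmpty (oddExceptLast isEven) ∘ descents

gf-dyckGoodOrEmpty : gf dyckGoodOrEmpty ≈ onePS ⊕ gf (dyckOddExceptLast isEven)
gf-dyckGoodOrEmpty = ≈-trans (gf-split orEmpty-split) (⊕-cong gf-null ≈-refl)
  where
  orEmpty-split : ∀ w → weight (dyckGoodOrEmpty w) ≡ weight (null w) + weight (dyckOddExceptLast isEven w)
  orEmpty-split []      = refl
  orEmpty-split (D ∷ w) = refl
  orEmpty-split (U ∷ w) with descentsAux 0 w in eq
  ... | []     rewrite no-descents-not-dyck 0 w eq = refl
  ... | e ∷ es = sym (ℤ.+-identityˡ _)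

E O : PS
E = gf (dyckOddExceptLast isEven)
O = gf (dyckOddExceptLast isOdd)

E-equation : E ≈ zpow 2 ⊛ (O ⊕ (onePS ⊕ E) ⊛ E)
E-equation = ≈-trans (gf-dyckOddExceptLast isEven) (⊛-congˡ (zpow 2)
  (⊕-cong (gf-cong (λ w → cong (isDyck w ∧_) (oddExceptLast-even-bump (descents w))))
          (⊛-congʳ E gf-dyckGoodOrEmpty)))

O-equation : O ≈ zpow 2 ⊛ ((onePS ⊕ E) ⊕ (onePS ⊕ E) ⊛ O)
O-equation = ≈-trans (gf-dyckOddExceptLast isOdd) (⊛-congˡ (zpow 2)
  (⊕-cong (≈-trans (gf-cong (λ w → cong (isDyck w ∧_) (oddExceptLast-odd-bump (descents w))))
                   gf-dyckGoodOrEmpty)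
          (⊛-congʳ O gf-dyckGoodOrEmpty)))

odd-length-not-dyck : ∀ w → isEven (length w) ≡ false → isDyck w ≡ false
odd-length-not-dyck w odd with isDyck w in dyck
... | false = refl
... | true  with () ← trans (sym odd)
                       (trans (cong isEven (sym (ℕ.+-identityʳ (length w)))) (dyckFrom-even 0 w dyck))

double-half : ∀ n → isEven n ≡ true → 2 ℕ.* ℕ.⌊ n /2⌋ ≡ n
double-half zero          _    = refl
double-half (suc (suc n)) even = cong suc (trans (ℕ.+-suc ℕ.⌊ n /2⌋ _) (cong suc (double-half n even)))

b-gf : ∀ m → + b m ≡ gf good (2 ℕ.* m)
b-gf zero    = refl
b-gf (suc m) = count-words (2 ℕ.* suc m) good

h₀≈E : h₀ ≈ E
h₀≈E n = trans h₀≈good (gf-cong (λ w → cong (isDyck w ∧_) (descCond-oddExceptLast (descents w))) n)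
  where
  h₀≈good : h₀ n ≡ gf good n
  h₀≈good with isEven n in even
  ... | true  = trans (b-gf ℕ.⌊ n /2⌋) (cong (gf good) (double-half n even))
  ... | false = sym (gf-vanishes n (λ w length≡n → cong (_∧ descCond (descents w))
                  (odd-length-not-dyck w (trans (cong isEven length≡n) even))))

mainTheorem2 : Σ PS (λ w → (w ⊛ w ⊛ w ⊕ (zpow 2 ⊖ zpow 0) ⊛ w ⊛ w ⊖ zpow 4 ⊛ w ⊕ zpow 4 ≈ zeroPS) × (w 0 ≡ + 1) × (w 1 ≡ + 0) × (w 2 ≡ - + 1) × (w 3 ≡ + 0) × (w 4 ≡ + 0) × (w 5 ≡ + 0) × (w 6 ≡ - + 1) × (w 7 ≡ + 0) × (w 8 ≡ - + 2) × ((w′ : PS) → w′ ⊛ w′ ⊛ w′ ⊕ (zpow 2 ⊖ zpow 0) ⊛ w′ ⊛ w′ ⊖ zpow 4 ⊛ w′ ⊕ zpow 4 ≈ zeroPS → w′ 0 ≡ + 1 → w′ ≈ w) × (h₀ ⊛ (w ⊛ w ⊖ zpow 4) ≈ zpow 4) × (zpow 2 ⊛ h₀ ≈ zpow 0 ⊖ w ⊖ zpow 2) × (b 1 ≡ 0) × (b 2 ≡ 1) × (b 3 ≡ 2) × (b 4 ≡ 4) × (b 5 ≡ 10) × (b 6 ≡ 26) × (b 7 ≡ 68))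
mainTheorem2 =
  w , w-root , refl , refl , refl , refl , refl , refl , refl , refl , refl ,
  (λ w′ w′-root w′₀ →
     cubic-unique {zpow 2 ⊖ zpow 0} {zpow 4} refl refl w′₀ refl (≈-trans w′-root (≈-sym w-root))) ,
  h₀-identity , shift-identity , refl , refl , refl , refl , refl , refl , refl
  where
  open GeneratingSystem (zpow 2) E O E-equation O-equation renaming (w to w-E)
  w : PS
  w = zpow 0 ⊖ zpow 2 ⊖ zpow 2 ⊛ h₀
  w≈w-E : w ≈ w-E
  w≈w-E = ⊖-cong (⊖-cong zpow-zero (≈-refl {zpow 2})) (⊛-congˡ (zpow 2) h₀≈E)
  zpow4≈X² : zpow 4 ≈ zpow 2 ⊛ zpow 2
  zpow4≈X² = zpow-+ 2 2
  w-root : cubic (zpow 2 ⊖ zpow 0) (zpow 4) w ≈ zeroPS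
  w-root = ≈-trans (cubic-cong (⊖-cong (≈-refl {zpow 2}) zpow-zero) zpow4≈X² w≈w-E) w-cubic
  h₀-identity : h₀ ⊛ (w ⊛ w ⊖ zpow 4) ≈ zpow 4
  h₀-identity = ≈-trans (⊛-cong h₀≈E (⊖-cong (⊛-cong w≈w-E w≈w-E) zpow4≈X²))
                        (≈-trans E-closed-form (≈-sym zpow4≈X²))
  shift-identity : zpow 2 ⊛ h₀ ≈ zpow 0 ⊖ w ⊖ zpow 2
  shift-identity n = cancel (zpow 0 n) (zpow 2 n) ((zpow 2 ⊛ h₀) n)
    where
    cancel : ∀ a c x → x ≡ a - (a - c - x) - c
    cancel = solve-∀
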